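{- Let $S=(1,s_2,\ldots)$ be a packing sequence and $k\ge 2$ an integer. (i) If $S\in\mathcal{S}(k)$, i.e. $2^{i-1}\le s_i<2^i$ for all $i\le k-1$ and $s_k<2^{k-1}$, then the path $P_n$ is $\chi_S$-vertex-critical if and only if $n\in\{2^0,2^1,\ldots,2^{k-1}\}$. (ii) If $2^{i-1}\le s_i<2^i$ holds for every entry $s_i$ of $S$, then $P_n$ is $\chi_S$-vertex-critical if and only if $n\in\{2^j : j\in\mathbb{N}_0\}$.
   Context: A packing sequence is a non-decreasing infinite sequence $S=(s_1,s_2,\ldots)$ of positive integers. For a graph $G$, a map $\phi\colon V(G)\to\{1,\ldots,k\}$ is an $S$-packing $k$-coloring if any two distinct vertices $u,v$ with $\phi(u)=\phi(v)=i$ satisfy $d_G(u,v) > s_i$; $\chi_S(G)$ is the least such $k$. A graph $G$ is $\chi_S$-vertex-critical if $\chi_S(G-v)<\chi_S(G)$ for every $v\in V(G)$. $P_n$ is the path on $n\ge1$ vertices. For $k\ge 2$, $\mathcal{S}(k)$ is the set of packing sequences with $2^{i-1}\le s_i<2^i$ for all $i\le k-1$ and $s_k<2^{k-1}$. -}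

module Defs where

open import Data.Nat using (ℕ; zero; suc; _+_; _∸_; _^_; _≤_; _<_)
open import Data.Fin using (Fin; toℕ; punchIn)
open import Data.Product using (Σ; ∃; _×_; _,_)
open import Data.Sum using (_⊎_)
open import Relation.Binary.PropositionalEquality using (_≡_; _≢_)
open import Relation.Nullary using (¬_)

Graph : ℕ → Set₁
Graph n = Fin n → Fin n → Set

Path : (n : ℕ) → Graph n
Path n i j = (toℕ j ≡ suc (toℕ i)) ⊎ (toℕ i ≡ suc (toℕ j))

deleteVertex : ∀ {m} → Graph (suc m) → Fin (suc m) → Graph m
deleteVertex G v i j = G (punchIn v i) (punchIn v j)

data Walk {n : ℕ} (G : Graph n) : Fin n → Fin n → ℕ → Set where
  here : ∀ {u} → Walk G u u zero
  step : ∀ {u v w ℓ} → G u v → Walk G v w ℓ → Walk G u w (suc ℓ)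

-- d_G(u,v) ≤ d  (distance is the length of a shortest walk;
-- infinite if there is none)
DistLe : ∀ {n} → Graph n → Fin n → Fin n → ℕ → Set
DistLe G u v d = Σ ℕ λ ℓ → ℓ ≤ d × Walk G u v ℓ

DistGt : ∀ {n} → Graph n → Fin n → Fin n → ℕ → Set
DistGt G u v d = ¬ DistLe G u v d

-- Packing sequences are functions s : ℕ → ℕ read from index 1
-- (s 0 is irrelevant): s_i = s i for i ≥ 1.
IsPackingSequence : (ℕ → ℕ) → Set
IsPackingSequence s =
  (∀ i → 1 ≤ i → 1 ≤ s i) × (∀ i j → 1 ≤ i → i ≤ j → s i ≤ s j)

-- S-packing k-coloring: φ : V → {1,…,k}, encoded as Fin k with colour
-- c ∈ Fin k standing for the colour toℕ c + 1.
IsPackingColoring : (s : ℕ → ℕ) → ∀ {n} → Graph n → (k : ℕ) → (Fin n → Fin k) → Set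
IsPackingColoring s G k φ =
  ∀ u v → u ≢ v → φ u ≡ φ v → DistGt G u v (s (suc (toℕ (φ u))))

PackingColorable : (s : ℕ → ℕ) → ∀ {n} → Graph n → ℕ → Set
PackingColorable s {n} G k = Σ (Fin n → Fin k) λ φ → IsPackingColoring s G k φ

IsPackingChromaticNumber : (s : ℕ → ℕ) → ∀ {n} → Graph n → ℕ → Set
IsPackingChromaticNumber s G k =
  PackingColorable s G k × (∀ m → m < k → ¬ PackingColorable s G m)

VertexCritical : (s : ℕ → ℕ) → ∀ {m} → Graph (suc m) → Set
VertexCritical s {m} G =
  ∀ (v : Fin (suc m)) (a b : ℕ) →
    IsPackingChromaticNumber s (deleteVertex G v) a →
    IsPackingChromaticNumber s G b → a < b

InClassS : (s : ℕ → ℕ) → ℕ → Set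
InClassS s k =
  (∀ i → 1 ≤ i → i ≤ k ∸ 1 → (2 ^ (i ∸ 1) ≤ s i) × (s i < 2 ^ i))
  × (s k < 2 ^ (k ∸ 1))

{-# OPTIONS --safe #-}
module Submission where

-- In an S-packing coloring of P_N, two vertices of color c (the paper's
-- color c + 1) are more than s_{c+1} apart, which on a path just means
-- |x - y| > s_{c+1}. If s_{c+1} ≥ 2^c for every color c < K, induction on j
-- shows that every block of 2^j consecutive vertices contains a color ≥ j,
-- so P_N has no K-coloring once N ≥ 2^K. Conversely, coloring position x by
-- the 2-adic valuation of x + 1, capped at b, is a packing coloring as soon
-- as s_{c+1} < 2^{c+1} for c < b: a color c < b recurs with period 2^{c+1},
-- the capped color b with period 2^b, which suffices when s_{b+1} < 2^b.
-- Hence χ_S(P_N) = ⌊log₂ N⌋ + 1, capped at k in case (i). Finally P_{m+1} - v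
-- is a spanning subgraph of P_m, equal to it for an end vertex v, so P_{m+1}
-- is critical iff χ_S(P_m) < χ_S(P_{m+1}), i.e. iff m + 1 is a power of two
-- (below the cap).

open import Defs
open import Data.Fin using (Fin; zero; suc; toℕ; fromℕ<; inject≤; punchIn)
open import Data.Fin.Properties
  using (toℕ-injective; toℕ-fromℕ<; toℕ<n; toℕ-inject≤; inject≤-injective; punchIn-injective)
open import Data.Nat
  using (ℕ; zero; suc; _+_; _*_; _∸_; _^_; _≤_; _<_; z≤n; s≤s; s≤s⁻¹; z<s; _<?_; ∣_-_∣; >-nonZero)
open import Data.Nat.Divisibility using (_∣_; 1∣_; ∣⇒≤; *-monoʳ-∣; ∣m+n∣m⇒∣n)
open import Data.Nat.Properties
open import Data.Nat.Tactic.RingSolver using (solve-∀)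
open import Data.Product using (Σ; Σ-syntax; _×_; _,_; proj₁; proj₂)
open import Data.Sum using (inj₁; inj₂) renaming (map to ⊎-map)
open import Function using (id; _∘_)
open import Function.Bundles using (_⇔_; mk⇔)
open import Function.Definitions using (Injective)
open import Relation.Binary using (tri<; tri≈; tri>)
open import Relation.Binary.PropositionalEquality
open import Relation.Nullary using (¬_; yes; no; contradiction)

private
  variable
    n n′ m K L a b j : ℕ
    G : Graph n
    H : Graph n′

walk-map : (f : Fin n → Fin n′) → (∀ {u v} → G u v → H (f u) (f v)) →
           ∀ {u v ℓ} → Walk G u v ℓ → Walk H (f u) (f v) ℓ
walk-map f hom here       = here
walk-map f hom (step e w) = step (hom e) (walk-map f hom w)

∣n-1+n∣≡1 : ∀ n → ∣ n - suc n ∣ ≡ 1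
∣n-1+n∣≡1 n = trans (m≤n⇒∣m-n∣≡n∸m (n≤1+n n)) (m+n∸n≡m 1 n)

path-edge-length : ∀ {u v : Fin n} → Path n u v → ∣ toℕ u - toℕ v ∣ ≡ 1
path-edge-length {u = u} (inj₁ v≡1+u) rewrite v≡1+u = ∣n-1+n∣≡1 (toℕ u)
path-edge-length {v = v} (inj₂ u≡1+v) rewrite u≡1+v =
  trans (∣-∣-comm (suc (toℕ v)) (toℕ v)) (∣n-1+n∣≡1 (toℕ v))

path-walk-length : ∀ {u v : Fin n} {ℓ} → Walk (Path n) u v ℓ → ∣ toℕ u - toℕ v ∣ ≤ ℓ
path-walk-length {u = u} here = ≤-reflexive (∣n-n∣≡0 (toℕ u))
path-walk-length {u = u} {v} (step {v = w} {ℓ = ℓ} e walk) = begin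
  ∣ toℕ u - toℕ v ∣                     ≤⟨ ∣-∣-triangle (toℕ u) (toℕ w) (toℕ v) ⟩
  ∣ toℕ u - toℕ w ∣ + ∣ toℕ w - toℕ v ∣ ≡⟨ cong (_+ ∣ toℕ w - toℕ v ∣) (path-edge-length e) ⟩
  suc ∣ toℕ w - toℕ v ∣                 ≤⟨ s≤s (path-walk-length walk) ⟩
  suc ℓ                                 ∎
  where open ≤-Reasoning

path-ascending-walk : ∀ d {u v : Fin n} → d + toℕ u ≡ toℕ v → Walk (Path n) u v d
path-ascending-walk zero {u} u≡v = subst (λ w → Walk (Path _) u w 0) (toℕ-injective u≡v) here
path-ascending-walk {n} (suc d) {u} {v} d+1+u≡v =
  step (inj₁ (toℕ-fromℕ< 1+u<n)) (path-ascending-walk d d+u′≡v)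
  where
  1+u<n : suc (toℕ u) < n
  1+u<n = ≤-<-trans (≤-trans (s≤s (m≤n+m (toℕ u) d)) (≤-reflexive d+1+u≡v)) (toℕ<n v)
  d+u′≡v : d + toℕ (fromℕ< 1+u<n) ≡ toℕ v
  d+u′≡v = trans (cong (d +_) (toℕ-fromℕ< 1+u<n)) (trans (+-suc d (toℕ u)) d+1+u≡v)

path-suc : ∀ {i j : Fin n} → Path n i j → Path (suc n) (suc i) (suc j)
path-suc = ⊎-map (cong suc) (cong suc)

path-suc⁻ : ∀ {i j : Fin n} → Path (suc n) (suc i) (suc j) → Path n i j
path-suc⁻ = ⊎-map suc-injective suc-injective

path-delete⊆ : ∀ (v : Fin (suc m)) {i j : Fin m} → deleteVertex (Path (suc m)) v i j → Path m i j
path-delete⊆ zero                          e        = path-suc⁻ e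
path-delete⊆ (suc v)       {zero}  {zero}  (inj₁ ())
path-delete⊆ (suc v)       {zero}  {zero}  (inj₂ ())
path-delete⊆ (suc zero)    {zero}  {suc j} (inj₁ ())
path-delete⊆ (suc zero)    {zero}  {suc j} (inj₂ ())
path-delete⊆ (suc (suc v)) {zero}  {suc zero} _ = inj₁ refl
path-delete⊆ (suc (suc v)) {zero}  {suc (suc j)} (inj₁ ())
path-delete⊆ (suc (suc v)) {zero}  {suc (suc j)} (inj₂ ())
path-delete⊆ (suc zero)    {suc i} {zero}  (inj₁ ())
path-delete⊆ (suc zero)    {suc i} {zero}  (inj₂ ())
path-delete⊆ (suc (suc v)) {suc zero} {zero} _ = inj₂ refl
path-delete⊆ (suc (suc v)) {suc (suc i)} {zero} (inj₁ ())
path-delete⊆ (suc (suc v)) {suc (suc i)} {zero} (inj₂ ())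
path-delete⊆ (suc v)       {suc i} {suc j} e = path-suc (path-delete⊆ v (path-suc⁻ e))

data Halving : ℕ → Set where
  even : ∀ h → Halving (h + h)
  odd  : ∀ h → Halving (suc (h + h))

halving : ∀ n → Halving n
halving zero = even 0
halving (suc n) with halving n
... | even h = odd h
... | odd  h = subst Halving (cong suc (+-suc h h)) (even (suc h))

halve-< : ∀ {m n} → m + m < n + n → m < n
halve-< m+m<n+n = ≰⇒> (λ n≤m → <⇒≱ m+m<n+n (+-mono-≤ n≤m n≤m))

double-gap : ∀ {p d q} → p + d ≤ q → p + p + 2 * d ≤ q + q
double-gap {p} {d} {q} p+d≤q = begin
  p + p + 2 * d       ≡⟨ doubling p d ⟩
  (p + d) + (p + d)   ≤⟨ +-mono-≤ p+d≤q p+d≤q ⟩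
  q + q               ∎
  where
  open ≤-Reasoning
  doubling : ∀ p d → p + p + 2 * d ≡ (p + d) + (p + d)
  doubling = solve-∀

-- ruler b p = min(ν₂ p, b) for p > 0.
ruler : ℕ → ℕ → ℕ
ruler zero    p = 0
ruler (suc b) p with halving p
... | even h = suc (ruler b h)
... | odd  h = 0

ruler≤ : ∀ b p → ruler b p ≤ b
ruler≤ zero    p = z≤n
ruler≤ (suc b) p with halving p
... | even h = s≤s (ruler≤ b h)
... | odd  h = z≤n

2^ruler∣ : ∀ b p → 2 ^ ruler b p ∣ p
2^ruler∣ zero    p = 1∣ p
2^ruler∣ (suc b) p with halving p
... | even h =
  subst (2 ^ suc (ruler b h) ∣_) (cong (h +_) (+-identityʳ h)) (*-monoʳ-∣ 2 (2^ruler∣ b h))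
... | odd  h = 1∣ _

ruler< : ∀ b x → suc x < 2 ^ b → ruler b (suc x) < b
ruler< b x 1+x<2^b with m≤n⇒m<n∨m≡n (ruler≤ b (suc x))
... | inj₁ r<b = r<b
... | inj₂ r≡b =
  contradiction (∣⇒≤ (subst (λ c → 2 ^ c ∣ suc x) r≡b (2^ruler∣ b (suc x)))) (<⇒≱ 1+x<2^b)

ruler-gap : ∀ b {p q} → p < q → ruler b p ≡ ruler b q → p + 2 ^ ruler b p ≤ q
ruler-gap b {p} {q} p<q eq = begin
  p + 2 ^ ruler b p ≤⟨ +-monoʳ-≤ p (∣⇒≤ {{>-nonZero (m<n⇒0<n∸m p<q)}} 2^r∣q∸p) ⟩
  p + (q ∸ p)       ≡⟨ p+[q∸p]≡q ⟩
  q                 ∎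
  where
  open ≤-Reasoning
  p+[q∸p]≡q : p + (q ∸ p) ≡ q
  p+[q∸p]≡q = m+[n∸m]≡n (<⇒≤ p<q)
  2^r∣q : 2 ^ ruler b p ∣ q
  2^r∣q = subst (λ c → 2 ^ c ∣ q) (sym eq) (2^ruler∣ b q)
  2^r∣q∸p : 2 ^ ruler b p ∣ q ∸ p
  2^r∣q∸p = ∣m+n∣m⇒∣n (subst (2 ^ ruler b p ∣_) (sym p+[q∸p]≡q) 2^r∣q) (2^ruler∣ b p)

ruler-gap-uncapped : ∀ b {p q} → p < q → ruler b p ≡ ruler b q → ruler b p < b →
                     p + 2 ^ suc (ruler b p) ≤ q
ruler-gap-uncapped (suc b) {p} {q} p<q eq r<b with halving p | halving q
ruler-gap-uncapped (suc b) p<q eq r<b | even hp | even hq =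
  double-gap {hp} {2 ^ suc (ruler b hp)}
    (ruler-gap-uncapped b (halve-< p<q) (suc-injective eq) (s≤s⁻¹ r<b))
ruler-gap-uncapped (suc b) p<q eq r<b | odd hp  | odd hq  =
  s≤s (double-gap {hp} {1} (subst (_≤ hq) (+-comm 1 hp) (halve-< (s≤s⁻¹ p<q))))
ruler-gap-uncapped (suc b) p<q () r<b | even hp | odd hq
ruler-gap-uncapped (suc b) p<q () r<b | odd hp  | even hq

between-powers : ∀ m → Σ[ j ∈ ℕ ] 2 ^ j ≤ suc m × suc m < 2 ^ suc j
between-powers zero = 0 , ≤-refl , s≤s (s≤s z≤n)
between-powers (suc m) with between-powers m
... | j , lo , hi with suc (suc m) <? 2 ^ suc j
...   | yes below = j , m≤n⇒m≤1+n lo , below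
...   | no ¬below =
  suc j , ≮⇒≥ ¬below , ≤-<-trans hi (^-monoʳ-< 2 (s≤s (s≤s z≤n)) (n<1+n (suc j)))

next-window⊆ : ∀ {a x} j → x < a + 2 ^ j → suc x + 2 ^ j ≤ a + 2 ^ suc j
next-window⊆ {a} {x} j x<a+2^j = begin
  suc x + 2 ^ j       ≤⟨ +-monoˡ-≤ (2 ^ j) x<a+2^j ⟩
  a + 2 ^ j + 2 ^ j   ≡⟨ +-assoc a (2 ^ j) (2 ^ j) ⟩
  a + (2 ^ j + 2 ^ j) ≡⟨ cong (λ t → a + (2 ^ j + t)) (+-identityʳ (2 ^ j)) ⟨
  a + 2 ^ suc j       ∎
  where open ≤-Reasoning

module _ (s : ℕ → ℕ) where

  colorable-pullback : (f : Fin n → Fin n′) → Injective _≡_ _≡_ f →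
                       (∀ {u v} → G u v → H (f u) (f v)) →
                       PackingColorable s H K → PackingColorable s G K
  colorable-pullback f f-inj hom (φ , packing) =
    φ ∘ f , λ u v u≢v φfu≡φfv (ℓ , ℓ≤ , w) →
      packing (f u) (f v) (u≢v ∘ f-inj) φfu≡φfv (ℓ , ℓ≤ , walk-map f hom w)

  colorable-⊆ : (∀ {u v} → G u v → H u v) → PackingColorable s H K → PackingColorable s G K
  colorable-⊆ = colorable-pullback id id

  colorable-delete : ∀ (v : Fin (suc n)) →
                     PackingColorable s G K → PackingColorable s (deleteVertex G v) K
  colorable-delete v = colorable-pullback (punchIn v) (punchIn-injective v _ _) id

  colorable-mono : K ≤ L → PackingColorable s G K → PackingColorable s G L
  colorable-mono {G = G} K≤L (φ , packing) =
    (λ u → inject≤ (φ u) K≤L) , λ u v u≢v eq d →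
      packing u v u≢v (inject≤-injective K≤L K≤L _ _ eq)
        (subst (λ c → DistLe G u v (s (suc c))) (toℕ-inject≤ (φ u) K≤L) d)

  chromatic≤colorable : IsPackingChromaticNumber s G a → PackingColorable s G K → a ≤ K
  chromatic≤colorable (_ , minimal) colorable = ≮⇒≥ (λ K<a → minimal _ K<a colorable)

  uncolorable<chromatic : IsPackingChromaticNumber s G b → ¬ PackingColorable s G K → K < b
  uncolorable<chromatic (colorable , _) ¬colorable =
    ≰⇒> (λ b≤K → ¬colorable (colorable-mono b≤K colorable))

  chromatic-suc : PackingColorable s G (suc K) → ¬ PackingColorable s G K →
                  IsPackingChromaticNumber s G (suc K)
  chromatic-suc colorable ¬colorable =
    colorable , λ L L<1+K → ¬colorable ∘ colorable-mono (s≤s⁻¹ L<1+K)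

  Spaced : ∀ {N K} → (Fin N → Fin K) → Set
  Spaced φ = ∀ {u v} → toℕ u < toℕ v → φ u ≡ φ v → toℕ u + s (suc (toℕ (φ u))) < toℕ v

  -- Color c : Fin K is the paper's color c + 1, so these say 2^{i-1} ≤ s_i,
  -- resp. s_i < 2^i, for all i ≤ b.
  DyadicLower : ℕ → Set
  DyadicLower b = ∀ {c} → c < b → 2 ^ c ≤ s (suc c)

  DyadicUpper : ℕ → Set
  DyadicUpper b = ∀ {c} → c < b → s (suc c) < 2 ^ suc c

  packing⇒spaced : ∀ {N K} {φ : Fin N → Fin K} → IsPackingColoring s (Path N) K φ → Spaced φ
  packing⇒spaced {φ = φ} packing {u} {v} u<v φu≡φv with toℕ u + s (suc (toℕ (φ u))) <? toℕ v
  ... | yes far = far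
  ... | no ¬far = contradiction
          (toℕ v ∸ toℕ u , m≤n+o⇒m∸n≤o (toℕ v) (toℕ u) (≮⇒≥ ¬far) ,
           path-ascending-walk _ (m∸n+n≡m (<⇒≤ u<v)))
          (packing u v u≢v φu≡φv)
    where
    u≢v : u ≢ v
    u≢v u≡v = <-irrefl (cong toℕ u≡v) u<v

  spaced⇒far : ∀ {N K} {φ : Fin N → Fin K} → Spaced φ → ∀ {x y} → toℕ x < toℕ y → φ x ≡ φ y →
               ¬ ∣ toℕ x - toℕ y ∣ ≤ s (suc (toℕ (φ x)))
  spaced⇒far {φ = φ} spaced {x} {y} x<y φx≡φy ∣x-y∣≤s = <⇒≱ (spaced x<y φx≡φy) (begin
    toℕ y                        ≤⟨ m≤n+∣n-m∣ (toℕ y) (toℕ x) ⟩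
    toℕ x + ∣ toℕ x - toℕ y ∣    ≤⟨ +-monoʳ-≤ (toℕ x) ∣x-y∣≤s ⟩
    toℕ x + s (suc (toℕ (φ x)))  ∎)
    where open ≤-Reasoning

  spaced⇒packing : ∀ {N K} {φ : Fin N → Fin K} → Spaced φ → IsPackingColoring s (Path N) K φ
  spaced⇒packing spaced u v u≢v φu≡φv (ℓ , ℓ≤s , walk) with <-cmp (toℕ u) (toℕ v)
  ... | tri< u<v _ _ = spaced⇒far spaced u<v φu≡φv (≤-trans (path-walk-length walk) ℓ≤s)
  ... | tri≈ _ u≡v _ = u≢v (toℕ-injective u≡v)
  ... | tri> _ _ v<u = spaced⇒far spaced v<u (sym φu≡φv)
          (subst₂ (λ d c → d ≤ s (suc (toℕ c))) (∣-∣-comm (toℕ u) (toℕ v)) φu≡φv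
            (≤-trans (path-walk-length walk) ℓ≤s))

  module _ {N K} {φ : Fin N → Fin K} (spaced : Spaced φ) (lower : DyadicLower K) where

    equal-colors-far : ∀ {x y} → toℕ x < toℕ y → φ x ≡ φ y → toℕ x + 2 ^ toℕ (φ x) < toℕ y
    equal-colors-far {x} x<y φx≡φy =
      ≤-<-trans (+-monoʳ-≤ (toℕ x) (lower (toℕ<n (φ x)))) (spaced x<y φx≡φy)

    high-color-in-window : ∀ j a → a + 2 ^ j ≤ N →
                            Σ[ x ∈ Fin N ] a ≤ toℕ x × toℕ x < a + 2 ^ j × j ≤ toℕ (φ x)
    high-color-in-window zero a a+1≤N =
      x , ≤-reflexive (sym x≡a) , subst (_< a + 1) (sym x≡a) (m<m+n a z<s) , z≤n
      where
      a<N : a < N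
      a<N = <-≤-trans (m<m+n a z<s) a+1≤N
      x : Fin N
      x = fromℕ< a<N
      x≡a : toℕ x ≡ a
      x≡a = toℕ-fromℕ< a<N
    high-color-in-window (suc j) a fits
      with high-color-in-window j a (≤-trans (+-monoʳ-≤ a (m≤m+n (2 ^ j) _)) fits)
    ... | x , a≤x , x<a+2^j , j≤φx with m≤n⇒m<n∨m≡n j≤φx
    ...   | inj₁ j<φx = x , a≤x , <-≤-trans x<a+2^j (+-monoʳ-≤ a (m≤m+n (2 ^ j) _)) , j<φx
    ...   | inj₂ j≡φx
      with high-color-in-window j (suc (toℕ x)) (≤-trans (next-window⊆ j x<a+2^j) fits)
    ...     | y , x<y , y<1+x+2^j , j≤φy with m≤n⇒m<n∨m≡n j≤φy
    ...       | inj₁ j<φy =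
      y , ≤-trans a≤x (<⇒≤ x<y) , <-≤-trans y<1+x+2^j (next-window⊆ j x<a+2^j) , j<φy
    ...       | inj₂ j≡φy = contradiction (s≤s⁻¹ y<1+x+2^j) (<⇒≱ x+2^j<y)
      where
      x+2^j<y : toℕ x + 2 ^ j < toℕ y
      x+2^j<y = subst (λ c → toℕ x + 2 ^ c < toℕ y) (sym j≡φx)
                  (equal-colors-far x<y (toℕ-injective (trans (sym j≡φx) j≡φy)))

  path-uncolorable : ∀ {N K} → DyadicLower K → 2 ^ K ≤ N → ¬ PackingColorable s (Path N) K
  path-uncolorable {K = K} lower 2^K≤N (φ , packing)
    with high-color-in-window (packing⇒spaced packing) lower K 0 2^K≤N
  ... | x , _ , _ , K≤φx = <⇒≱ (toℕ<n (φ x)) K≤φx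

  path-colorable-by : ∀ {N K} (κ : ℕ → ℕ) (κ<K : ∀ (u : Fin N) → κ (toℕ u) < K) →
    (∀ {u v : Fin N} → toℕ u < toℕ v → κ (toℕ u) ≡ κ (toℕ v) →
                       toℕ u + s (suc (κ (toℕ u))) < toℕ v) →
    PackingColorable s (Path N) K
  path-colorable-by {N} {K} κ κ<K gap = φ , spaced⇒packing spaced
    where
    φ : Fin N → Fin K
    φ u = fromℕ< (κ<K u)
    spaced : Spaced φ
    spaced {u} {v} u<v φu≡φv =
      subst (λ c → toℕ u + s (suc c) < toℕ v) (sym (toℕ-fromℕ< (κ<K u)))
        (gap u<v (trans (sym (toℕ-fromℕ< (κ<K u))) (trans (cong toℕ φu≡φv) (toℕ-fromℕ< (κ<K v)))))

  path-colorable : ∀ {N K} → DyadicUpper K → N < 2 ^ K → PackingColorable s (Path N) K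
  path-colorable {N} {K} upper N<2^K = path-colorable-by (λ x → ruler K (suc x)) κ<K gap
    where
    κ<K : ∀ (u : Fin N) → ruler K (suc (toℕ u)) < K
    κ<K u = ruler< K (toℕ u) (≤-<-trans (toℕ<n u) N<2^K)
    gap : ∀ {u v : Fin N} → toℕ u < toℕ v → ruler K (suc (toℕ u)) ≡ ruler K (suc (toℕ v)) →
          toℕ u + s (suc (ruler K (suc (toℕ u)))) < toℕ v
    gap {u} u<v eq = <-≤-trans (+-monoʳ-< (toℕ u) (upper (κ<K u)))
                               (s≤s⁻¹ (ruler-gap-uncapped K (s≤s u<v) eq (κ<K u)))

  path-colorable-capped : ∀ {N b} → DyadicUpper b → s (suc b) < 2 ^ b →
                          PackingColorable s (Path N) (suc b)
  path-colorable-capped {N} {b} upper cap =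
    path-colorable-by (λ x → ruler b (suc x)) (λ u → s≤s (ruler≤ b _)) gap
    where
    gap : ∀ {u v : Fin N} → toℕ u < toℕ v → ruler b (suc (toℕ u)) ≡ ruler b (suc (toℕ v)) →
          toℕ u + s (suc (ruler b (suc (toℕ u)))) < toℕ v
    gap {u} u<v eq with m≤n⇒m<n∨m≡n (ruler≤ b (suc (toℕ u)))
    ... | inj₁ r<b = <-≤-trans (+-monoʳ-< (toℕ u) (upper r<b))
                               (s≤s⁻¹ (ruler-gap-uncapped b (s≤s u<v) eq r<b))
    ... | inj₂ r≡b = <-≤-trans (+-monoʳ-< (toℕ u) (subst (λ c → s (suc c) < 2 ^ c) (sym r≡b) cap))
                               (s≤s⁻¹ (ruler-gap b (s≤s u<v) eq))

  path-critical : PackingColorable s (Path m) K → ¬ PackingColorable s (Path (suc m)) K →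
                  VertexCritical s (Path (suc m))
  path-critical colorable ¬colorable v a b χ-deleted χ-path =
    ≤-<-trans (chromatic≤colorable χ-deleted (colorable-⊆ (path-delete⊆ v) colorable))
              (uncolorable<chromatic χ-path ¬colorable)

  path-not-critical : ¬ PackingColorable s (Path m) K → PackingColorable s (Path (suc m)) (suc K) →
                      ¬ VertexCritical s (Path (suc m))
  path-not-critical {m} {K} ¬colorable colorable critical =
    <-irrefl refl (critical zero (suc K) (suc K) χ-deleted χ-path)
    where
    from-deleted : ∀ {L} → PackingColorable s (deleteVertex (Path (suc m)) zero) L →
                   PackingColorable s (Path m) L
    from-deleted = colorable-⊆ path-suc
    χ-deleted : IsPackingChromaticNumber s (deleteVertex (Path (suc m)) zero) (suc K)
    χ-deleted = chromatic-suc (colorable-delete zero colorable) (¬colorable ∘ from-deleted)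
    χ-path : IsPackingChromaticNumber s (Path (suc m)) (suc K)
    χ-path = chromatic-suc colorable (¬colorable ∘ from-deleted ∘ colorable-delete zero)

  path-critical-at-power : DyadicLower j → DyadicUpper j → suc m ≡ 2 ^ j →
                           VertexCritical s (Path (suc m))
  path-critical-at-power lower upper 1+m≡2^j =
    path-critical (path-colorable upper (≤-reflexive 1+m≡2^j))
                  (path-uncolorable lower (≤-reflexive (sym 1+m≡2^j)))

  critical⇒power : DyadicLower j → 2 ^ j ≤ suc m → PackingColorable s (Path (suc m)) (suc j) →
                   VertexCritical s (Path (suc m)) → suc m ≡ 2 ^ j
  critical⇒power lower 2^j≤1+m colorable critical with m≤n⇒m<n∨m≡n 2^j≤1+m
  ... | inj₁ 2^j<1+m =
    contradiction critical (path-not-critical (path-uncolorable lower (s≤s⁻¹ 2^j<1+m)) colorable)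
  ... | inj₂ 2^j≡1+m = sym 2^j≡1+m

  critical-paths-capped : ∀ b → DyadicLower b → DyadicUpper b → s (suc b) < 2 ^ b → ∀ m →
                          VertexCritical s (Path (suc m)) ⇔ (Σ[ j ∈ ℕ ] j < suc b × suc m ≡ 2 ^ j)
  critical-paths-capped b lower upper cap m = mk⇔ to from
    where
    to : VertexCritical s (Path (suc m)) → Σ[ j ∈ ℕ ] j < suc b × suc m ≡ 2 ^ j
    to critical with between-powers m
    ... | j , lo , hi with j <? b
    ...   | yes j<b = j , m<n⇒m<1+n j<b ,
              critical⇒power (λ c<j → lower (<-trans c<j j<b)) lo
                (path-colorable (λ c<1+j → upper (<-≤-trans c<1+j j<b)) hi) critical
    ...   | no j≮b = b , ≤-refl ,
              critical⇒power lower (≤-trans (^-monoʳ-≤ 2 (≮⇒≥ j≮b)) lo)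
                (path-colorable-capped upper cap) critical
    from : Σ[ j ∈ ℕ ] j < suc b × suc m ≡ 2 ^ j → VertexCritical s (Path (suc m))
    from (j , j<1+b , 1+m≡2^j) =
      path-critical-at-power (λ c<j → lower (<-≤-trans c<j (s≤s⁻¹ j<1+b)))
                             (λ c<j → upper (<-≤-trans c<j (s≤s⁻¹ j<1+b))) 1+m≡2^j

  critical-paths-dyadic : (∀ {b} → DyadicLower b) → (∀ {b} → DyadicUpper b) → ∀ m →
                          VertexCritical s (Path (suc m)) ⇔ (Σ[ j ∈ ℕ ] suc m ≡ 2 ^ j)
  critical-paths-dyadic lower upper m = mk⇔ to from
    where
    to : VertexCritical s (Path (suc m)) → Σ[ j ∈ ℕ ] suc m ≡ 2 ^ j
    to critical with between-powers m
    ... | j , lo , hi = j , critical⇒power {j = j} lower lo (path-colorable upper hi) critical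
    from : Σ[ j ∈ ℕ ] suc m ≡ 2 ^ j → VertexCritical s (Path (suc m))
    from (j , 1+m≡2^j) = path-critical-at-power {j = j} lower upper 1+m≡2^j

corollary3p6 : (s : ℕ → ℕ) → IsPackingSequence s → s 1 ≡ 1 →
    ((k : ℕ) → 2 ≤ k → InClassS s k →
      (m : ℕ) → (VertexCritical s (Path (suc m)) ⇔ Σ ℕ (λ j → j < k × suc m ≡ 2 ^ j)))
    × ((∀ i → 1 ≤ i → (2 ^ (i ∸ 1) ≤ s i) × (s i < 2 ^ i)) →
      (m : ℕ) → (VertexCritical s (Path (suc m)) ⇔ Σ ℕ (λ j → suc m ≡ 2 ^ j)))
corollary3p6 s _ _ = in-class , dyadic
  where
  in-class : (k : ℕ) → 2 ≤ k → InClassS s k →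
             (m : ℕ) → VertexCritical s (Path (suc m)) ⇔ Σ ℕ (λ j → j < k × suc m ≡ 2 ^ j)
  in-class (suc b) _ (bounds , cap) =
    critical-paths-capped s b (λ c<b → proj₁ (bounds _ z<s c<b))
                              (λ c<b → proj₂ (bounds _ z<s c<b)) cap
  dyadic : (∀ i → 1 ≤ i → (2 ^ (i ∸ 1) ≤ s i) × (s i < 2 ^ i)) →
           (m : ℕ) → VertexCritical s (Path (suc m)) ⇔ Σ ℕ (λ j → suc m ≡ 2 ^ j)
  dyadic bounds = critical-paths-dyadic s (λ _ → proj₁ (bounds _ z<s)) (λ _ → proj₂ (bounds _ z<s))
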